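{- Let $p > 3$ be a prime and let $J$ be a sequence of elements of $(\mathbb{Z}/p\mathbb{Z})^3$ with $|J| = 4p - 4$. Then $$1 - (p-1 \mid J) - (p \mid J) + (2p-1 \mid J) + (2p \mid J) - (3p-1 \mid J) - (3p \mid J) \equiv 0 \pmod p.$$
   Context: A sequence is a finite list of elements (repetitions allowed); a subsequence is obtained by selecting any subset of the positions (not necessarily consecutive), and it is zero-sum if its terms sum to $0$. For a sequence $J$ and an integer $k \geq 1$, $(k \mid J)$ denotes the number of zero-sum subsequences of $J$ of length $k$, i.e. the number of $k$-element subsets of the index set of $J$ whose corresponding terms sum to $0$. -}

module Defs where

open import Data.Nat using (ℕ; zero; suc; _+_; _*_; _%_; NonZero)
open import Data.Fin using (Fin; toℕ)
open import Data.Fin.Subset using (Subset; ∣_∣; inside; outside)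
open import Data.Product using (_×_; _,_)
open import Data.Vec using (Vec; []; _∷_; lookup)
open import Data.List using (List; []; _∷_; map; _++_; filter; length)
open import Data.Bool using (Bool; true; false; if_then_else_)
open import Relation.Binary.PropositionalEquality using (_≡_)
open import Relation.Nullary.Decidable using (_×-dec_; Dec)
open import Data.Nat using (_≟_)
import Data.Fin as F

-- An element of (ℤ/pℤ)^3, each coordinate a residue class represented by Fin p.
ZpCube : ℕ → Set
ZpCube p = Fin p × Fin p × Fin p

Seq : ℕ → ℕ → Set
Seq p n = Vec (ZpCube p) n

allSubsets : (n : ℕ) → List (Subset n)
allSubsets zero = [] ∷ []
allSubsets (suc n) = map (outside ∷_) (allSubsets n) ++ map (inside ∷_) (allSubsets n)

sumSel : ∀ {p n} → Seq p n → Subset n → ℕ × ℕ × ℕ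
sumSel [] [] = 0 , 0 , 0
sumSel (x ∷ xs) (b ∷ bs) with sumSel xs bs
... | (a , b' , c) with x
...   | (x₁ , x₂ , x₃) = if b then (toℕ x₁ + a , toℕ x₂ + b' , toℕ x₃ + c) else (a , b' , c)

ZeroSum : ∀ {p n} → .{{NonZero p}} → Seq p n → Subset n → Set
ZeroSum {p} J S with sumSel J S
... | (a , b , c) = (a % p ≡ 0) × (b % p ≡ 0) × (c % p ≡ 0)

zeroSum? : ∀ {p n} → .{{_ : NonZero p}} → (J : Seq p n) → (S : Subset n) → Dec (ZeroSum J S)
zeroSum? {p} J S with sumSel J S
... | (a , b , c) = (a % p ≟ 0) ×-dec ((b % p ≟ 0) ×-dec (c % p ≟ 0))

-- (k | J): number of k-element subsets of the index set whose terms sum to 0.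
count : ∀ {p n} → .{{_ : NonZero p}} → ℕ → Seq p n → ℕ
count {n = n} k J = length (filter (λ S → (∣ S ∣ ≟ k) ×-dec zeroSum? J S) (allSubsets n))

module Submission where

-- The proof is the polynomial method phrased with finite differences.  For v ∈ ℕ⁴ put
--   f(v) = [p ∣ v₁] [p ∣ v₂] [p ∣ v₃] ([p ∣ v₄ + 1] - [p ∣ v₄]).
-- By Fermat's little theorem [p ∣ s] ≡ 1 - s^(p-1) (mod p), so modulo p the function f
-- behaves like a polynomial of degree 3(p-1) + (p-2) < 4p - 4 = |J|: every |J|-fold
-- difference of f vanishes mod p.  Take the differences along the terms x of J, lifted to
-- (x₁, x₂, x₃, 1).  By inclusion–exclusion this difference is a signed sum of f(Σ S) over the
-- subsequences S; the first three factors say that S is zero-sum, the last coordinate of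
-- Σ S is |S|, and a computation with base-p digits shows that the sign times
-- [p ∣ |S| + 1] - [p ∣ |S|] is minus the coefficient of (|S| | J) in the theorem.

open import Data.Nat using (ℕ; suc)
open import Data.Nat.Primality using (Prime)
open import Data.Integer using (ℤ)
open import Relation.Binary.PropositionalEquality using (_≡_)

module Sums where
  open import Data.Integer using (+_; _+_; _*_; -_)
  open import Data.Integer.Properties using (+-identityˡ; +-assoc; neg-distrib-+)
  open import Data.Integer.Tactic.RingSolver using (solve-∀)
  open import Data.List using (List; []; _∷_; _++_; map; filter; length)
  open import Relation.Nullary using (Dec; yes; no; ¬_)
  open import Relation.Nullary.Decidable using (_×-dec_)
  open import Relation.Binary.PropositionalEquality using (refl; sym; trans; cong; cong₂; _≗_)
  open import Data.Empty using (⊥-elim)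

  sumOver : ∀ {A : Set} → List A → (A → ℤ) → ℤ
  sumOver [] f = + 0
  sumOver (x ∷ xs) f = f x + sumOver xs f

  syntax sumOver xs (λ x → e) = ∑[ x ∈ xs ] e

  sum-cong : ∀ {A : Set} (xs : List A) {f g : A → ℤ} → f ≗ g → sumOver xs f ≡ sumOver xs g
  sum-cong [] e = refl
  sum-cong (x ∷ xs) e = cong₂ _+_ (e x) (sum-cong xs e)

  sum-++ : ∀ {A : Set} (xs ys : List A) f → sumOver (xs ++ ys) f ≡ sumOver xs f + sumOver ys f
  sum-++ [] ys f = sym (+-identityˡ _)
  sum-++ (x ∷ xs) ys f = trans (cong (_+_ (f x)) (sum-++ xs ys f)) (sym (+-assoc (f x) _ _))

  sum-map : ∀ {A B : Set} (g : A → B) (xs : List A) f → sumOver (map g xs) f ≡ ∑[ x ∈ xs ] f (g x)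
  sum-map g [] f = refl
  sum-map g (x ∷ xs) f = cong (_+_ (f (g x))) (sum-map g xs f)

  sum-+ : ∀ {A : Set} (xs : List A) f g → ∑[ x ∈ xs ] (f x + g x) ≡ sumOver xs f + sumOver xs g
  sum-+ [] f g = refl
  sum-+ (x ∷ xs) f g = trans (cong (_+_ (f x + g x)) (sum-+ xs f g)) (interchange (f x) (g x) _ _)
    where
    interchange : ∀ a b c d → (a + b) + (c + d) ≡ (a + c) + (b + d)
    interchange = solve-∀

  sum-neg : ∀ {A : Set} (xs : List A) f → ∑[ x ∈ xs ] (- f x) ≡ - sumOver xs f
  sum-neg [] f = refl
  sum-neg (x ∷ xs) f = trans (cong (_+_ (- f x)) (sum-neg xs f)) (sym (neg-distrib-+ (f x) _))

  sum-zero : ∀ {A : Set} (xs : List A) → ∑[ x ∈ xs ] (+ 0) ≡ + 0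
  sum-zero [] = refl
  sum-zero (x ∷ xs) = trans (+-identityˡ _) (sum-zero xs)

  𝟙 : ∀ {A : Set} → Dec A → ℤ
  𝟙 (yes _) = + 1
  𝟙 (no _) = + 0

  𝟙-yes : ∀ {A : Set} (d : Dec A) → A → 𝟙 d ≡ + 1
  𝟙-yes (yes _) a = refl
  𝟙-yes (no ¬a) a = ⊥-elim (¬a a)

  𝟙-no : ∀ {A : Set} (d : Dec A) → ¬ A → 𝟙 d ≡ + 0
  𝟙-no (yes a) ¬a = ⊥-elim (¬a a)
  𝟙-no (no _) ¬a = refl

  𝟙-× : ∀ {A B : Set} (a : Dec A) (b : Dec B) → 𝟙 (a ×-dec b) ≡ 𝟙 a * 𝟙 b
  𝟙-× (yes _) (yes _) = refl
  𝟙-× (yes _) (no _) = refl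
  𝟙-× (no _) (yes _) = refl
  𝟙-× (no _) (no _) = refl

  length-filter : ∀ {A : Set} {P : A → Set} (P? : ∀ x → Dec (P x)) (xs : List A) →
                  + length (filter P? xs) ≡ ∑[ x ∈ xs ] (𝟙 (P? x))
  length-filter P? [] = refl
  length-filter P? (x ∷ xs) with P? x
  ... | yes _ = cong (_+_ (+ 1)) (length-filter P? xs)
  ... | no _ = trans (length-filter P? xs) (sym (+-identityˡ _))

module Subsets where
  open import Data.Nat as ℕ using (zero; _≟_)
  open import Data.Nat.Properties using (*-comm)
  open import Data.Integer using (+_; -1ℤ; _+_; _*_; -_; _^_)
  open import Data.Integer.Properties using (^-distribˡ-+-*; ^-*-assoc; ^-zeroˡ; +-identityʳ; *-identityˡ)
  open import Data.Integer.Tactic.RingSolver using (solve-∀)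
  open import Data.Fin.Subset using (Subset; ⊥; ∣_∣; inside; outside)
  open import Data.Vec using ([]; _∷_)
  open import Data.List using (map; _++_)
  open import Relation.Binary.PropositionalEquality using (refl; sym; trans; cong; cong₂; module ≡-Reasoning)
  open import Defs using (allSubsets)
  open Sums

  sign : ℕ → ℤ
  sign k = -1ℤ ^ k

  sign-+ : ∀ a b → sign (a ℕ.+ b) ≡ sign a * sign b
  sign-+ = ^-distribˡ-+-* -1ℤ

  sign-2* : ∀ d → sign (2 ℕ.* d) ≡ + 1
  sign-2* d = trans (sym (^-*-assoc -1ℤ 2 d)) (^-zeroˡ d)

  sign-*-odd : ∀ {p} → sign p ≡ -1ℤ → ∀ q → sign (q ℕ.* p) ≡ sign q
  sign-*-odd {p} odd q = begin
    sign (q ℕ.* p)   ≡⟨ cong sign (*-comm q p) ⟩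
    sign (p ℕ.* q)   ≡⟨ sym (^-*-assoc -1ℤ p q) ⟩
    sign p ^ q       ≡⟨ cong (_^ q) odd ⟩
    sign q           ∎
    where open ≡-Reasoning

  coSign : ∀ {n} → Subset n → ℤ
  coSign [] = + 1
  coSign (outside ∷ S) = - coSign S
  coSign (inside ∷ S) = coSign S

  -- coSign S = (-1)^(n - |S|), written without subtraction.
  coSign≡ : ∀ {n} (S : Subset n) → coSign S ≡ sign n * sign ∣ S ∣
  coSign≡ [] = refl
  coSign≡ {suc n} (outside ∷ S) = trans (cong -_ (coSign≡ S)) (flip (sign n) (sign ∣ S ∣))
    where
    flip : ∀ a b → - (a * b) ≡ (-1ℤ * a) * b
    flip = solve-∀
  coSign≡ {suc n} (inside ∷ S) = trans (coSign≡ S) (flip² (sign n) (sign ∣ S ∣))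
    where
    flip² : ∀ a b → a * b ≡ (-1ℤ * a) * (-1ℤ * b)
    flip² = solve-∀

  sum-size-zero : ∀ n (g : Subset n → ℤ) → ∑[ S ∈ allSubsets n ] (𝟙 (∣ S ∣ ≟ 0) * g S) ≡ g ⊥
  sum-size-zero zero g = trans (+-identityʳ _) (*-identityˡ (g []))
  sum-size-zero (suc n) g = begin
    sumOver (map (outside ∷_) A ++ map (inside ∷_) A) h        ≡⟨ sum-++ (map (outside ∷_) A) _ h ⟩
    sumOver (map (outside ∷_) A) h + sumOver (map (inside ∷_) A) h
      ≡⟨ cong₂ _+_ (sum-map (outside ∷_) A h) (sum-map (inside ∷_) A h) ⟩
    ∑[ S ∈ A ] (𝟙 (∣ S ∣ ≟ 0) * g (outside ∷ S)) + ∑[ S ∈ A ] (+ 0)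
      ≡⟨ cong₂ _+_ (sum-size-zero n (λ S → g (outside ∷ S))) (sum-zero A) ⟩
    g ⊥ + + 0                                                   ≡⟨ +-identityʳ (g ⊥) ⟩
    g ⊥ ∎
    where
    open ≡-Reasoning
    A = allSubsets n
    h : Subset (suc n) → ℤ
    h S = 𝟙 (∣ S ∣ ≟ 0) * g S

module FiniteDifferences
  {V : Set} (_⊕_ : V → V → V) (origin : V)
  (⊕-assoc : ∀ x y z → (x ⊕ y) ⊕ z ≡ x ⊕ (y ⊕ z))
  (⊕-comm : ∀ x y → x ⊕ y ≡ y ⊕ x)
  (⊕-identityʳ : ∀ x → x ⊕ origin ≡ x)
  (P : ℤ) where

  open import Data.Nat as ℕ using (zero; _≤_; z≤n; s≤s)
  open import Data.Nat.Properties using (≤-trans; +-suc)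
  open import Data.Integer using (+_; _+_; _-_; _*_; -_)
  open import Data.Integer.Properties using (+-inverseʳ; pos-+; pos-*; *-identityˡ; +-identityʳ)
  open import Data.Integer.Divisibility.Signed
    using (_∣_; divides; ∣m∣n⇒∣m+n; ∣m∣n⇒∣m-n; ∣m⇒∣m*n; ∣n⇒∣m*n; ∣m+n∣n⇒∣m; ∣m⇒∣-m)
  open import Data.Integer.Tactic.RingSolver using (solve-∀)
  open import Data.Vec using (Vec; []; _∷_)
  open import Data.Fin.Subset using (Subset; ⊥; inside; outside)
  open import Data.List using (map)
  open import Relation.Binary.PropositionalEquality
    using (refl; sym; trans; cong; cong₂; subst; _≗_; module ≡-Reasoning)
  open import Defs using (allSubsets)
  open Sums
  open Subsets using (coSign)

  -- Translations commute; this makes differences in different directions commute.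
  ⊕-swap : ∀ x b c → (x ⊕ b) ⊕ c ≡ (x ⊕ c) ⊕ b
  ⊕-swap x b c = trans (⊕-assoc x b c) (trans (cong (x ⊕_) (⊕-comm b c)) (sym (⊕-assoc x c b)))

  Fn : Set
  Fn = V → ℤ

  _⊖_ _⊞_ _⊠_ : Fn → Fn → Fn
  (F ⊖ G) x = F x - G x
  (F ⊞ G) x = F x + G x
  (F ⊠ G) x = F x * G x

  shift : V → Fn → Fn
  shift c F x = F (x ⊕ c)

  Δ : V → Fn → Fn
  Δ b F x = F (x ⊕ b) - F x

  Δ⋆ : ∀ {n} → Vec V n → Fn → Fn
  Δ⋆ [] F = F
  Δ⋆ (b ∷ bs) F = Δ⋆ bs (Δ b F)

  Vanishes : Fn → Set
  Vanishes F = ∀ x → P ∣ F x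

  -- F behaves modulo P like a polynomial of degree < d: all its d-fold differences vanish.
  DegreeBelow : ℕ → Fn → Set
  DegreeBelow d F = ∀ {n} (bs : Vec V n) → d ≤ n → Vanishes (Δ⋆ bs F)

  Δ⋆-cong : ∀ {n} (bs : Vec V n) {F G} → F ≗ G → Δ⋆ bs F ≗ Δ⋆ bs G
  Δ⋆-cong [] e = e
  Δ⋆-cong (b ∷ bs) e = Δ⋆-cong bs (λ x → cong₂ _-_ (e _) (e x))

  Δ⋆-⊖ : ∀ {n} (bs : Vec V n) F G → Δ⋆ bs (F ⊖ G) ≗ Δ⋆ bs F ⊖ Δ⋆ bs G
  Δ⋆-⊖ [] F G x = refl
  Δ⋆-⊖ (b ∷ bs) F G x =
    trans (Δ⋆-cong bs (λ y → regroup (F (y ⊕ b)) (G (y ⊕ b)) (F y) (G y)) x) (Δ⋆-⊖ bs (Δ b F) (Δ b G) x)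
    where
    regroup : ∀ a b c d → (a - b) - (c - d) ≡ (a - c) - (b - d)
    regroup = solve-∀

  Δ⋆-⊞ : ∀ {n} (bs : Vec V n) F G → Δ⋆ bs (F ⊞ G) ≗ Δ⋆ bs F ⊞ Δ⋆ bs G
  Δ⋆-⊞ [] F G x = refl
  Δ⋆-⊞ (b ∷ bs) F G x =
    trans (Δ⋆-cong bs (λ y → regroup (F (y ⊕ b)) (G (y ⊕ b)) (F y) (G y)) x) (Δ⋆-⊞ bs (Δ b F) (Δ b G) x)
    where
    regroup : ∀ a b c d → (a + b) - (c + d) ≡ (a - c) + (b - d)
    regroup = solve-∀

  Δ⋆-shift : ∀ {n} (bs : Vec V n) F c → Δ⋆ bs (shift c F) ≗ shift c (Δ⋆ bs F)
  Δ⋆-shift [] F c x = refl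
  Δ⋆-shift (b ∷ bs) F c x =
    trans (Δ⋆-cong bs (λ y → cong (λ z → F z - F (y ⊕ c)) (⊕-swap y b c)) x) (Δ⋆-shift bs (Δ b F) c x)

  vanishes-Δ⋆ : ∀ {n} (bs : Vec V n) {F} → Vanishes F → Vanishes (Δ⋆ bs F)
  vanishes-Δ⋆ [] z = z
  vanishes-Δ⋆ (b ∷ bs) z = vanishes-Δ⋆ bs (λ x → ∣m∣n⇒∣m-n (z _) (z x))

  degreeBelow-≗ : ∀ {d F G} → F ≗ G → DegreeBelow d G → DegreeBelow d F
  degreeBelow-≗ e deg bs le x = subst (P ∣_) (sym (Δ⋆-cong bs e x)) (deg bs le x)

  degreeBelow-mod : ∀ {d F G} → Vanishes (F ⊖ G) → DegreeBelow d G → DegreeBelow d F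
  degreeBelow-mod {F = F} {G} z deg bs le x =
    ∣m+n∣n⇒∣m (subst (P ∣_) (Δ⋆-⊖ bs F G x) (vanishes-Δ⋆ bs z x)) (∣m⇒∣-m (deg bs le x))

  degreeBelow-⊖ : ∀ {d F G} → DegreeBelow d F → DegreeBelow d G → DegreeBelow d (F ⊖ G)
  degreeBelow-⊖ {F = F} {G} degF degG bs le x =
    subst (P ∣_) (sym (Δ⋆-⊖ bs F G x)) (∣m∣n⇒∣m-n (degF bs le x) (degG bs le x))

  degreeBelow-mono : ∀ {d e F} → d ≤ e → DegreeBelow d F → DegreeBelow e F
  degreeBelow-mono d≤e deg bs le = deg bs (≤-trans d≤e le)

  degreeBelow-Δ : ∀ {d F} b → DegreeBelow (suc d) F → DegreeBelow d (Δ b F)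
  degreeBelow-Δ b deg bs le = deg (b ∷ bs) (s≤s le)

  degreeBelow-shift : ∀ {d F} c → DegreeBelow d F → DegreeBelow d (shift c F)
  degreeBelow-shift {F = F} c deg bs le x = subst (P ∣_) (sym (Δ⋆-shift bs F c x)) (deg bs le (x ⊕ c))

  degreeBelow-const : ∀ K → DegreeBelow 1 (λ _ → K)
  degreeBelow-const K (b ∷ bs) le =
    vanishes-Δ⋆ bs (λ x → subst (P ∣_) (sym (+-inverseʳ K)) (divides (+ 0) refl))

  Δ-⊠ : ∀ b F G → Δ b (F ⊠ G) ≗ (Δ b F ⊠ shift b G) ⊞ (F ⊠ Δ b G)
  Δ-⊠ b F G x = leibniz (F (x ⊕ b)) (G (x ⊕ b)) (F x) (G x)
    where
    leibniz : ∀ a b c d → a * b - c * d ≡ (a - c) * b + c * (b - d)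
    leibniz = solve-∀

  -- Degrees add under multiplication: deg (F G) < a + b + 1 when deg F < a + 1, deg G < b + 1.
  -- By Leibniz, one difference of F G is a sum of two products in which one factor has lost
  -- a degree; a factor of degree < 0 vanishes mod P, and otherwise we recurse.
  degreeBelow-⊠ : ∀ a b {F G} → DegreeBelow (suc a) F → DegreeBelow (suc b) G →
                  DegreeBelow (suc (a ℕ.+ b)) (F ⊠ G)
  degreeBelow-⊠ a b {F} {G} degF degG {suc n} (c ∷ bs) (s≤s le) x =
    subst (P ∣_) (sym (trans (Δ⋆-cong bs (Δ-⊠ c F G) x) (Δ⋆-⊞ bs _ _ x)))
          (∣m∣n⇒∣m+n (differentiateF a degF le) (differentiateG b degG le))
    where
    differentiateF : ∀ a → DegreeBelow (suc a) F → a ℕ.+ b ≤ n → P ∣ Δ⋆ bs (Δ c F ⊠ shift c G) x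
    differentiateF zero degF le =
      vanishes-Δ⋆ bs (λ y → ∣m⇒∣m*n (shift c G y) (degreeBelow-Δ c degF [] z≤n y)) x
    differentiateF (suc a) degF le = degreeBelow-⊠ a b (degreeBelow-Δ c degF) (degreeBelow-shift c degG) bs le x
    differentiateG : ∀ b → DegreeBelow (suc b) G → a ℕ.+ b ≤ n → P ∣ Δ⋆ bs (F ⊠ Δ c G) x
    differentiateG zero degG le =
      vanishes-Δ⋆ bs (λ y → ∣n⇒∣m*n (F y) (degreeBelow-Δ c degG [] z≤n y)) x
    differentiateG (suc b) degG le =
      degreeBelow-⊠ a b degF (degreeBelow-Δ c degG) bs (subst (_≤ n) (+-suc a b) le) x

  -- An additive map π : V → ℕ is "linear": its differences are constant.
  degreeBelow-additive : (π : V → ℕ) → (∀ x b → π (x ⊕ b) ≡ π x ℕ.+ π b) → DegreeBelow 2 (λ v → + π v)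
  degreeBelow-additive π π-⊕ (b ∷ bs) (s≤s le) = degreeBelow-≗ Δπ≡πb (degreeBelow-const (+ π b)) bs le
    where
    cancel : ∀ a c → (a + c) - a ≡ c
    cancel = solve-∀
    Δπ≡πb : Δ b (λ v → + π v) ≗ (λ _ → + π b)
    Δπ≡πb x = begin
      + π (x ⊕ b) - + π x          ≡⟨ cong (λ m → + m - + π x) (π-⊕ x b) ⟩
      + (π x ℕ.+ π b) - + π x      ≡⟨ cong (_- + π x) (pos-+ (π x) (π b)) ⟩
      (+ π x + + π b) - + π x      ≡⟨ cancel (+ π x) (+ π b) ⟩
      + π b                        ∎
      where open ≡-Reasoning

  degreeBelow-power : (π : V → ℕ) → (∀ x b → π (x ⊕ b) ≡ π x ℕ.+ π b) →
                      ∀ k → DegreeBelow (suc k) (λ v → + (π v ℕ.^ k))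
  degreeBelow-power π π-⊕ zero = degreeBelow-const (+ 1)
  degreeBelow-power π π-⊕ (suc k) =
    degreeBelow-≗ (λ v → pos-* (π v) (π v ℕ.^ k))
                  (degreeBelow-⊠ 1 k (degreeBelow-additive π π-⊕) (degreeBelow-power π π-⊕ k))

  selectedSum : ∀ {n} → Vec V n → Subset n → V
  selectedSum [] [] = origin
  selectedSum (b ∷ bs) (outside ∷ S) = selectedSum bs S
  selectedSum (b ∷ bs) (inside ∷ S) = b ⊕ selectedSum bs S

  selectedSum-⊥ : ∀ {n} (bs : Vec V n) → selectedSum bs ⊥ ≡ origin
  selectedSum-⊥ [] = refl
  selectedSum-⊥ (b ∷ bs) = selectedSum-⊥ bs

  Δ⋆-expansion : ∀ {n} (bs : Vec V n) F x →
                 Δ⋆ bs F x ≡ ∑[ S ∈ allSubsets n ] (coSign S * F (x ⊕ selectedSum bs S))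
  Δ⋆-expansion [] F x = sym (trans (+-identityʳ _) (trans (*-identityˡ _) (cong F (⊕-identityʳ x))))
  Δ⋆-expansion {suc n} (b ∷ bs) F x = begin
    Δ⋆ bs (Δ b F) x
      ≡⟨ Δ⋆-expansion bs (Δ b F) x ⟩
    ∑[ S ∈ A ] (coSign S * (F ((x ⊕ v S) ⊕ b) - F (x ⊕ v S)))
      ≡⟨ sum-cong A (λ S → trans (split (coSign S) _ _)
                                  (cong (λ y → - coSign S * F (x ⊕ v S) + coSign S * F y) (reorder (v S)))) ⟩
    ∑[ S ∈ A ] (- coSign S * F (x ⊕ v S) + coSign S * F (x ⊕ (b ⊕ v S)))
      ≡⟨ sum-+ A _ _ ⟩
    ∑[ S ∈ A ] (- coSign S * F (x ⊕ v S)) + ∑[ S ∈ A ] (coSign S * F (x ⊕ (b ⊕ v S)))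
      ≡⟨ sym (cong₂ _+_ (sum-map (outside ∷_) A term) (sum-map (inside ∷_) A term)) ⟩
    sumOver (map (outside ∷_) A) term + sumOver (map (inside ∷_) A) term
      ≡⟨ sym (sum-++ (map (outside ∷_) A) _ term) ⟩
    sumOver (allSubsets (suc n)) term ∎
    where
    open ≡-Reasoning
    A = allSubsets n
    v : Subset n → V
    v = selectedSum bs
    term : Subset (suc n) → ℤ
    term S = coSign S * F (x ⊕ selectedSum (b ∷ bs) S)
    split : ∀ e a c → e * (a - c) ≡ - e * c + e * a
    split = solve-∀
    reorder : ∀ u → (x ⊕ u) ⊕ b ≡ x ⊕ (b ⊕ u)
    reorder u = trans (⊕-assoc x u b) (cong (x ⊕_) (⊕-comm u b))

module Fermat where
  open import Data.Nat
  open import Data.Nat.Properties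
  open import Data.Nat.Divisibility
  open import Data.Nat.DivMod using (m/n*n≡m)
  open import Data.Nat.Primality using (Prime; euclidsLemma; ¬prime[1])
  open import Data.Nat.Combinatorics using (_C_; nCn≡1; k![n∸k]!∣n!)
  open import Data.Nat.Combinatorics.Specification using (nCk≡n!/k![n-k]!)
  open import Data.Nat.Tactic.RingSolver using (solve-∀)
  open import Data.Fin as Fin using (Fin; toℕ; fromℕ; inject₁)
  open import Data.Fin.Properties using (toℕ-inject₁; toℕ<n; toℕ-fromℕ)
  open import Data.Vec.Functional using (Vector; init)
  open import Data.Product using (∃; _,_)
  open import Data.Sum using (inj₁; inj₂)
  open import Data.Empty using (⊥-elim)
  open import Relation.Nullary using (¬_)
  open import Relation.Binary.PropositionalEquality
  open import Algebra.Properties.CommutativeSemiring.Binomial +-*-commutativeSemiring using (theorem)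
  open import Algebra.Properties.Monoid.Sum +-0-monoid using (sum; sum-init-last)
  open import Algebra.Definitions.RawSemiring +-*-rawSemiring using () renaming (_^_ to _^ₛ_; _×_ to _×ₛ_)

  ×ₛ≡* : ∀ n x → n ×ₛ x ≡ n * x
  ×ₛ≡* zero x = refl
  ×ₛ≡* (suc n) x = cong (x +_) (×ₛ≡* n x)

  ^ₛ≡^ : ∀ x n → x ^ₛ n ≡ x ^ n
  ^ₛ≡^ x zero = refl
  ^ₛ≡^ x (suc n) = cong (x *_) (^ₛ≡^ x n)

  ∣-sum : ∀ {d n} (f : Vector ℕ n) → (∀ i → d ∣ f i) → d ∣ sum f
  ∣-sum {d} {zero} f h = d ∣0
  ∣-sum {n = suc n} f h = ∣m∣n⇒∣m+n (h Fin.zero) (∣-sum (λ i → f (Fin.suc i)) (λ i → h (Fin.suc i)))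

  -- A prime does not divide j! for j < p, as it divides none of the factors.
  prime∤! : ∀ {p} → Prime p → ∀ j → j < p → ¬ p ∣ j !
  prime∤! isPrime zero j<p p∣1 = ¬prime[1] (subst Prime (∣1⇒≡1 p∣1) isPrime)
  prime∤! isPrime (suc j) j<p p∣j! with euclidsLemma (suc j) (j !) isPrime p∣j!
  ... | inj₁ p∣1+j = <⇒≱ j<p (∣⇒≤ p∣1+j)
  ... | inj₂ p∣j! = prime∤! isPrime j (<-trans (n<1+n j) j<p) p∣j!

  module _ {q : ℕ} (isPrime : Prime (suc q)) where

    -- The inner binomial coefficients (p choose k), 0 < k < p, are multiples of p:
    -- p divides p! = (p choose k) k! (p - k)! but neither k! nor (p - k)!.
    prime∣C : ∀ {k} → 0 < k → k < suc q → suc q ∣ suc q C k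
    prime∣C {k} 0<k k<p with euclidsLemma (suc q C k) (k ! * (suc q ∸ k) !) isPrime p∣product
      where
      instance _ = k !* (suc q ∸ k) !≢0
      p!≡product : (suc q C k) * (k ! * (suc q ∸ k) !) ≡ suc q !
      p!≡product = trans (cong (_* (k ! * (suc q ∸ k) !)) (nCk≡n!/k![n-k]! (<⇒≤ k<p)))
                         (m/n*n≡m (k![n∸k]!∣n! (<⇒≤ k<p)))
      p∣product : suc q ∣ (suc q C k) * (k ! * (suc q ∸ k) !)
      p∣product = subst (suc q ∣_) (sym p!≡product) (m∣m*n (q !))
    ... | inj₁ p∣C = p∣C
    ... | inj₂ p∣k![p∸k]! with euclidsLemma (k !) ((suc q ∸ k) !) isPrime p∣k![p∸k]!
    ...   | inj₁ p∣k! = ⊥-elim (prime∤! isPrime k k<p p∣k!)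
    ...   | inj₂ p∣[p∸k]! = ⊥-elim (prime∤! isPrime (suc q ∸ k) (∸-monoʳ-< 0<k (<⇒≤ k<p)) p∣[p∸k]!)

    freshman : ∀ s → ∃ λ d → (s + 1) ^ suc q ≡ 1 + (s ^ suc q + d * suc q)
    freshman s = quotient middle-divisible , (begin
        (s + 1) ^ suc q                              ≡⟨ sym (^ₛ≡^ (s + 1) (suc q)) ⟩
        (s + 1) ^ₛ suc q                             ≡⟨ theorem (suc q) s 1 ⟩
        term Fin.zero + sum inner                    ≡⟨ cong (term Fin.zero +_) (sum-init-last inner) ⟩
        term Fin.zero + (sum (init inner) + term (Fin.suc (fromℕ q)))
          ≡⟨ cong₂ (λ a b → a + (b + term (Fin.suc (fromℕ q)))) first≡1 (_∣_.equality middle-divisible) ⟩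
        1 + (d * suc q + term (Fin.suc (fromℕ q)))   ≡⟨ cong (λ z → 1 + (d * suc q + z)) last≡s^p ⟩
        1 + (d * suc q + s ^ suc q)                  ≡⟨ cong (1 +_) (+-comm (d * suc q) _) ⟩
        1 + (s ^ suc q + d * suc q)                  ∎)
      where
      open ≡-Reasoning
      term : Fin (suc (suc q)) → ℕ
      term k = (suc q C toℕ k) ×ₛ ((s ^ₛ toℕ k) * (1 ^ₛ (suc q ∸ toℕ k)))
      inner : Vector ℕ (suc q)
      inner k = term (Fin.suc k)
      middle-divisible : suc q ∣ sum (init inner)
      middle-divisible = ∣-sum (init inner) λ k →
        subst (suc q ∣_) (sym (×ₛ≡* (suc q C toℕ (Fin.suc (inject₁ k))) _))
              (∣m⇒∣m*n _ (prime∣C (s≤s z≤n) (s≤s (subst (_< q) (sym (toℕ-inject₁ k)) (toℕ<n k)))))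
      d : ℕ
      d = quotient middle-divisible
      first≡1 : term Fin.zero ≡ 1
      first≡1 rewrite trans (^ₛ≡^ 1 (suc q)) (^-zeroˡ (suc q)) = refl
      last≡s^p : term (Fin.suc (fromℕ q)) ≡ s ^ suc q
      last≡s^p rewrite toℕ-fromℕ q | nCn≡1 (suc q) | n∸n≡0 q =
        trans (+-identityʳ _) (trans (*-identityʳ _) (^ₛ≡^ s (suc q)))

    -- Fermat's little theorem: s^p ≡ s (mod p), by induction on s using the freshman's dream.
    fermat : ∀ s → ∃ λ K → s ^ suc q ≡ s + K * suc q
    fermat zero = 0 , refl
    fermat (suc s) with fermat s | freshman s
    ... | K , s^p≡ | d , dream = K + d , (begin
        suc s ^ suc q                           ≡⟨ cong (_^ suc q) (+-comm 1 s) ⟩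
        (s + 1) ^ suc q                         ≡⟨ dream ⟩
        1 + (s ^ suc q + d * suc q)             ≡⟨ cong (λ z → 1 + (z + d * suc q)) s^p≡ ⟩
        1 + ((s + K * suc q) + d * suc q)       ≡⟨ collect s K d (suc q) ⟩
        suc s + (K + d) * suc q                 ∎)
      where
      open ≡-Reasoning
      collect : ∀ s K d p → 1 + ((s + K * p) + d * p) ≡ 1 + s + (K + d) * p
      collect = solve-∀

module DivisibilityIndicator {r : ℕ} (isPrime : Prime (suc (suc r))) where
  open import Data.Nat as ℕ using (_%_; _≟_; _^_)
  open import Data.Nat.Divisibility using (m%n≡0⇒n∣m; n∣m⇒m%n≡0; n∣m*n; ∣m⇒∣m*n) renaming (_∣_ to _∣ℕ_)
  open import Data.Nat.Primality using (euclidsLemma)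
  open import Data.Integer using (+_; _+_; _-_; _*_; ∣_∣)
  open import Data.Integer.Properties using (pos-*; pos-+; abs-*)
  open import Data.Integer.Divisibility.Signed using (_∣_; ∣ᵤ⇒∣)
  open import Data.Integer.Tactic.RingSolver using (solve-∀)
  open import Data.Product using (_,_)
  open import Data.Sum using (inj₁; inj₂)
  open import Data.Empty using (⊥-elim)
  open import Relation.Nullary using (yes; no; ¬_)
  open import Relation.Binary.PropositionalEquality using (sym; trans; cong; subst; module ≡-Reasoning)
  open Sums using (𝟙)
  open Fermat using (fermat)

  p : ℕ
  p = suc (suc r)

  -- Fermat's little theorem in the form p ∣ s^(p-1) - 1 for p ∤ s: p divides
  -- s (s^(p-1) - 1) = s^p - s but not s.
  fermat-unit : ∀ s → ¬ s % p ≡ 0 → (+ p) ∣ (+ (s ^ suc r) - + 1)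
  fermat-unit s s%p≢0 with fermat isPrime s
  ... | K , s^p≡ = ∣ᵤ⇒∣ p∣x
    where
    x = + (s ^ suc r) - + 1
    s*x≡Kp : + s * x ≡ + (K ℕ.* p)
    s*x≡Kp = begin
      + s * (+ (s ^ suc r) - + 1)     ≡⟨ expand (+ s) (+ (s ^ suc r)) ⟩
      + s * + (s ^ suc r) - + s       ≡⟨ cong (_- + s) (sym (pos-* s (s ^ suc r))) ⟩
      + (s ^ p) - + s                 ≡⟨ cong (λ z → + z - + s) s^p≡ ⟩
      + (s ℕ.+ K ℕ.* p) - + s         ≡⟨ cong (_- + s) (pos-+ s (K ℕ.* p)) ⟩
      (+ s + + (K ℕ.* p)) - + s       ≡⟨ cancel (+ s) (+ (K ℕ.* p)) ⟩
      + (K ℕ.* p)                     ∎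
      where
      open ≡-Reasoning
      expand : ∀ a b → a * (b - + 1) ≡ a * b - a
      expand = solve-∀
      cancel : ∀ a b → (a + b) - a ≡ b
      cancel = solve-∀
    p∣s*x : p ∣ℕ s ℕ.* ∣ x ∣
    p∣s*x = subst (p ∣ℕ_) (trans (cong ∣_∣ (sym s*x≡Kp)) (abs-* (+ s) x)) (n∣m*n K)
    p∣x : p ∣ℕ ∣ x ∣
    p∣x with euclidsLemma s ∣ x ∣ isPrime p∣s*x
    ... | inj₁ p∣s = ⊥-elim (s%p≢0 (n∣m⇒m%n≡0 s p p∣s))
    ... | inj₂ p∣x = p∣x

  -- [p ∣ s] ≡ 1 - s^(p-1) (mod p): if p ∣ s both sides are ≡ 1, otherwise both are ≡ 0.
  indicator≡1-power : ∀ s → (+ p) ∣ (𝟙 (s % p ≟ 0) - (+ 1 - + (s ^ suc r)))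
  indicator≡1-power s with s % p ≟ 0
  ... | yes s%p≡0 = subst ((+ p) ∣_) (sym (1-[1-x] (+ (s ^ suc r))))
                          (∣ᵤ⇒∣ (∣m⇒∣m*n (s ^ r) (m%n≡0⇒n∣m s p s%p≡0)))
    where
    1-[1-x] : ∀ x → + 1 - (+ 1 - x) ≡ x
    1-[1-x] = solve-∀
  ... | no s%p≢0 = subst ((+ p) ∣_) (sym (0-[1-x] (+ (s ^ suc r)))) (fermat-unit s s%p≢0)
    where
    0-[1-x] : ∀ x → + 0 - (+ 1 - x) ≡ x - + 1
    0-[1-x] = solve-∀

module Weights (u : ℕ) (isPrime : Prime (suc (suc (suc (suc u))))) where
  open import Data.Nat as ℕ using (suc; z≤n; s≤s; _%_; _/_; _≟_; _≤_; _<_; _∸_)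
  open import Data.Nat.Properties as ℕ
    using (n<1+n; ≤-pred; ≤∧≢⇒<; ≤-trans; <-irrefl; <-≤-trans; m≤n+m; m≤m+n; +-monoˡ-<; *-monoˡ-≤;
           +-cancelˡ-≡; *-cancelʳ-≡; *-comm; +-identityʳ)
  open import Data.Nat.DivMod using (m≡m%n+[m/n]*n; m%n<n; [m+kn]%n≡m%n; m<n⇒m%n≡m; m*n%n≡0)
  open import Data.Nat.Divisibility using (divides)
  open import Data.Nat.Primality using (prime⇒irreducible)
  open import Data.Integer using (+_; -1ℤ; _+_; _-_; _*_; -_)
  open import Data.Integer.Tactic.RingSolver using (solve-∀)
  open import Data.List using (List; []; _∷_)
  open import Data.Product using (_×_; _,_; proj₁; proj₂)
  open import Data.Sum using (inj₁; inj₂)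
  open import Data.Empty using (⊥-elim)
  open import Relation.Nullary using (¬_; yes; no)
  open import Relation.Binary.PropositionalEquality using (refl; sym; trans; cong; cong₂; subst; module ≡-Reasoning)
  open Sums
  open Subsets using (sign; sign-+; sign-2*; sign-*-odd)

  p m n : ℕ
  p = suc (suc (suc (suc u)))
  m = suc (suc (suc u))
  n = 4 ℕ.* p ∸ 4

  φ : ℕ → ℤ
  φ s = 𝟙 (s % p ≟ 0)

  -- The alternating combination of the theorem; c is the term of length 0.
  Λ : ℤ → (ℕ → ℤ) → ℤ
  Λ c g = c - g (p ∸ 1) - g p + g (2 ℕ.* p ∸ 1) + g (2 ℕ.* p) - g (3 ℕ.* p ∸ 1) - g (3 ℕ.* p)

  Λ-cong : ∀ {c c' g g'} → c ≡ c' → (∀ j → g j ≡ g' j) → Λ c g ≡ Λ c' g'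
  Λ-cong {c} {c'} {g} {g'} refl e = cong₂ _-_ (cong₂ _-_ (cong₂ _+_ (cong₂ _+_ (cong₂ _-_ (cong₂ _-_ (refl {x = c})
    (e (p ∸ 1))) (e p)) (e (2 ℕ.* p ∸ 1))) (e (2 ℕ.* p))) (e (3 ℕ.* p ∸ 1))) (e (3 ℕ.* p))

  Λ-scaleʳ : ∀ z c g → Λ c g * z ≡ Λ (c * z) (λ j → g j * z)
  Λ-scaleʳ z c g = distrib z c (g (p ∸ 1)) (g p) (g (2 ℕ.* p ∸ 1)) (g (2 ℕ.* p)) (g (3 ℕ.* p ∸ 1)) (g (3 ℕ.* p))
    where
    distrib : ∀ z a b c d e f g → (a - b - c + d + e - f - g) * z ≡ a * z - b * z - c * z + d * z + e * z - f * z - g * z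
    distrib = solve-∀

  sum-Λ : ∀ {A : Set} (xs : List A) (c : A → ℤ) (g : A → ℕ → ℤ) →
          ∑[ x ∈ xs ] (Λ (c x) (g x)) ≡ Λ (sumOver xs c) (λ j → ∑[ x ∈ xs ] (g x j))
  sum-Λ [] c g = refl
  sum-Λ (x ∷ xs) c g = trans (cong (_+_ (Λ (c x) (g x))) (sum-Λ xs c g))
    (add (c x) (g x (p ∸ 1)) (g x p) (g x (2 ℕ.* p ∸ 1)) (g x (2 ℕ.* p)) (g x (3 ℕ.* p ∸ 1)) (g x (3 ℕ.* p))
         (sumOver xs c) (G (p ∸ 1)) (G p) (G (2 ℕ.* p ∸ 1)) (G (2 ℕ.* p)) (G (3 ℕ.* p ∸ 1)) (G (3 ℕ.* p)))
    where
    G : ℕ → ℤ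
    G j = ∑[ y ∈ xs ] (g y j)
    add : ∀ a b c d e f g A B C D E F G → (a - b - c + d + e - f - g) + (A - B - C + D + E - F - G) ≡
          (a + A) - (b + B) - (c + C) + (d + D) + (e + E) - (f + F) - (g + G)
    add = solve-∀

  θ : ℕ → ℤ
  θ k = Λ (𝟙 (k ≟ 0)) (λ j → 𝟙 (k ≟ j))

  -- p is an odd prime, so p - 1 is even (if it were odd, 2 would divide p) and p is odd.
  sign-m : sign m ≡ + 1
  sign-m with m % 2 | m%n<n m 2 | m≡m%n+[m/n]*n m 2
  ... | 0 | _ | m≡ = trans (cong sign (trans m≡ (*-comm (m / 2) 2))) (sign-2* (m / 2))
  ... | suc (suc _) | s≤s (s≤s ()) | _
  ... | 1 | _ | m≡ with prime⇒irreducible isPrime {2} (divides (suc (m / 2)) (cong suc m≡))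
  ...   | inj₁ ()
  ...   | inj₂ ()

  sign-p : sign p ≡ -1ℤ
  sign-p = cong (-1ℤ *_) sign-m

  digits-mod : ∀ {r} q → r < p → (r ℕ.+ q ℕ.* p) % p ≡ r
  digits-mod {r} q r<p = trans ([m+kn]%n≡m%n r q p) (m<n⇒m%n≡m r<p)

  digits-unique : ∀ {r r'} q q' → r < p → r' < p → r ℕ.+ q ℕ.* p ≡ r' ℕ.+ q' ℕ.* p → r ≡ r' × q ≡ q'
  digits-unique {r} q q' r<p r'<p e =
    r≡r' , *-cancelʳ-≡ q q' p (+-cancelˡ-≡ r _ _ (trans e (cong (ℕ._+ q' ℕ.* p) (sym r≡r'))))
    where
    r≡r' = trans (sym (digits-mod q r<p)) (trans (cong (_% p) e) (digits-mod q' r'<p))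

  𝟙-digits : ∀ {r r' X} q q' → r < p → r' < p → X ≡ r' ℕ.+ q' ℕ.* p →
             𝟙 (r ℕ.+ q ℕ.* p ≟ X) ≡ 𝟙 (r ≟ r') * 𝟙 (q ≟ q')
  𝟙-digits {r} {r'} q q' r<p r'<p refl with r ≟ r' | q ≟ q'
  ... | yes refl | yes refl = 𝟙-yes (r ℕ.+ q ℕ.* p ≟ r ℕ.+ q ℕ.* p) refl
  ... | no r≢r' | _ =
    𝟙-no (r ℕ.+ q ℕ.* p ≟ r' ℕ.+ q' ℕ.* p) (λ e → r≢r' (proj₁ (digits-unique q q' r<p r'<p e)))
  ... | yes refl | no q≢q' =
    𝟙-no (r ℕ.+ q ℕ.* p ≟ r ℕ.+ q' ℕ.* p) (λ e → q≢q' (proj₂ (digits-unique q q' r<p r'<p e)))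

  -- θ in terms of the digits (r, q) of the length, through a = [r = 0] and b = [r = m]:
  -- the lengths of the theorem have digits (0,0), (m,0), (0,1), (m,1), (0,2), (m,2), (0,3).
  digitWeight : ℤ → ℤ → ℕ → ℤ
  digitWeight a b q = a * 𝟙 (q ≟ 0) - b * 𝟙 (q ≟ 0) - a * 𝟙 (q ≟ 1) + b * 𝟙 (q ≟ 1)
                    + a * 𝟙 (q ≟ 2) - b * 𝟙 (q ≟ 2) - a * 𝟙 (q ≟ 3)

  θ-digits : ∀ r q → r < p → θ (r ℕ.+ q ℕ.* p) ≡ digitWeight (𝟙 (r ≟ 0)) (𝟙 (r ≟ m)) q
  θ-digits r q r<p = cong₂ _-_ (cong₂ _-_ (cong₂ _+_ (cong₂ _+_ (cong₂ _-_ (cong₂ _-_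
      (𝟙-digits q 0 r<p 0<p refl)
      (𝟙-digits q 0 r<p m<p (sym (+-identityʳ m))))
      (𝟙-digits q 1 r<p 0<p (sym (+-identityʳ p))))
      (𝟙-digits q 1 r<p m<p refl))
      (𝟙-digits q 2 r<p 0<p refl))
      (𝟙-digits q 2 r<p m<p refl))
      (𝟙-digits q 3 r<p 0<p refl)
    where
    0<p : 0 < p
    0<p = s≤s z≤n
    m<p : m < p
    m<p = n<1+n m

  -- Lengths are at most n = 4p - 4: so the second digit is at most 3, and at most 2
  -- when the first digit is m, since m + 3p = 4p - 1 > n.
  four-digits-too-long : ∀ r q → ¬ (r ℕ.+ (4 ℕ.+ q) ℕ.* p ≤ n)
  four-digits-too-long r q le = <-irrefl refl (<-≤-trans n<4p (≤-trans 4p≤ le))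
    where
    n<4p : n < 4 ℕ.* p
    n<4p = +-monoˡ-< (3 ℕ.* p) (m≤n+m (suc u) 3)
    4p≤ : 4 ℕ.* p ≤ r ℕ.+ (4 ℕ.+ q) ℕ.* p
    4p≤ = ≤-trans (*-monoˡ-≤ p (m≤m+n 4 q)) (m≤n+m _ r)

  m+3p-too-long : ¬ (m ℕ.+ 3 ℕ.* p ≤ n)
  m+3p-too-long le = <-irrefl refl (<-≤-trans (s≤s (m≤n+m n 2)) le)

  weight-multiple : ∀ q → q ≤ 3 → digitWeight (+ 1) (+ 0) q ≡ sign q
  weight-multiple 0 _ = refl
  weight-multiple 1 _ = refl
  weight-multiple 2 _ = refl
  weight-multiple 3 _ = refl
  weight-multiple (suc (suc (suc (suc q)))) (s≤s (s≤s (s≤s ())))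

  weight-before-multiple : ∀ q → q ≤ 2 → digitWeight (+ 0) (+ 1) q ≡ - sign q
  weight-before-multiple 0 _ = refl
  weight-before-multiple 1 _ = refl
  weight-before-multiple 2 _ = refl
  weight-before-multiple (suc (suc (suc q))) (s≤s (s≤s ()))

  few-digits : ∀ r q → r ℕ.+ q ℕ.* p ≤ n → q ≤ 3
  few-digits r 0 le = z≤n
  few-digits r 1 le = s≤s z≤n
  few-digits r 2 le = s≤s (s≤s z≤n)
  few-digits r 3 le = s≤s (s≤s (s≤s z≤n))
  few-digits r (suc (suc (suc (suc q)))) le = ⊥-elim (four-digits-too-long r q le)

  fewer-digits : ∀ q → m ℕ.+ q ℕ.* p ≤ n → q ≤ 2
  fewer-digits 0 le = z≤n
  fewer-digits 1 le = s≤s z≤n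
  fewer-digits 2 le = s≤s (s≤s z≤n)
  fewer-digits 3 le = ⊥-elim (m+3p-too-long le)
  fewer-digits (suc (suc (suc (suc q)))) le = ⊥-elim (four-digits-too-long m q le)

  difference-table : ∀ r q → r ℕ.+ q ℕ.* p ≤ n →
                     sign r * sign q * (𝟙 (r ≟ m) - 𝟙 (r ≟ 0)) ≡ - digitWeight (𝟙 (r ≟ 0)) (𝟙 (r ≟ m)) q
  difference-table r q le with r ≟ 0 | r ≟ m
  ... | yes refl | yes ()
  ... | yes refl | no _ = trans (negate (sign q)) (cong -_ (sym (weight-multiple q (few-digits 0 q le))))
    where
    negate : ∀ s → + 1 * s * (+ 0 - + 1) ≡ - s
    negate = solve-∀
  ... | no _ | yes refl = trans (cong (λ s → s * sign q * (+ 1 - + 0)) sign-m)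
                                (trans (double-negate (sign q)) (cong -_ (sym (weight-before-multiple q (fewer-digits q le)))))
    where
    double-negate : ∀ s → + 1 * s * (+ 1 - + 0) ≡ - - s
    double-negate = solve-∀
  ... | no _ | no _ = annihilate (sign r * sign q)
    where
    annihilate : ∀ s → s * (+ 0 - + 0) ≡ + 0
    annihilate = solve-∀

  φ-digits : ∀ {r} q → r < p → φ (r ℕ.+ q ℕ.* p) ≡ 𝟙 (r ≟ 0)
  φ-digits q r<p = cong (λ z → 𝟙 (z ≟ 0)) (digits-mod q r<p)

  φ-next-digits : ∀ {r} q → r < p → φ (suc r ℕ.+ q ℕ.* p) ≡ 𝟙 (r ≟ m)
  φ-next-digits {r} q r<p with r ≟ m
  ... | yes refl = cong (λ z → 𝟙 (z ≟ 0)) (m*n%n≡0 (suc q) p)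
  ... | no r≢m = cong (λ z → 𝟙 (z ≟ 0)) (digits-mod q (s≤s (≤∧≢⇒< (≤-pred r<p) r≢m)))

  weight-as-difference : ∀ k → k ≤ n → sign k * (φ (suc k) - φ k) ≡ - θ k
  weight-as-difference k k≤n = subst (λ z → sign z * (φ (suc z) - φ z) ≡ - θ z) (sym k≡r+qp) (begin
    sign (r ℕ.+ q ℕ.* p) * (φ (suc r ℕ.+ q ℕ.* p) - φ (r ℕ.+ q ℕ.* p))
      ≡⟨ cong₂ _*_ (trans (sign-+ r (q ℕ.* p)) (cong (sign r *_) (sign-*-odd sign-p q)))
                   (cong₂ _-_ (φ-next-digits q r<p) (φ-digits q r<p)) ⟩
    sign r * sign q * (𝟙 (r ≟ m) - 𝟙 (r ≟ 0))
      ≡⟨ difference-table r q (subst (_≤ n) k≡r+qp k≤n) ⟩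
    - digitWeight (𝟙 (r ≟ 0)) (𝟙 (r ≟ m)) q
      ≡⟨ cong -_ (sym (θ-digits r q r<p)) ⟩
    - θ (r ℕ.+ q ℕ.* p) ∎)
    where
    open ≡-Reasoning
    r = k % p
    q = k / p
    r<p : r < p
    r<p = m%n<n k p
    k≡r+qp : k ≡ r ℕ.+ q ℕ.* p
    k≡r+qp = m≡m%n+[m/n]*n k p

module ZeroSumCounting (u : ℕ) (isPrime : Prime (suc (suc (suc (suc u))))) where
  open import Data.Nat as ℕ using (suc; z≤n; s≤s; _%_; _≟_)
  open import Data.Nat.Properties using (+-assoc; +-comm; +-identityʳ; +-identityˡ; ≤-reflexive)
  import Data.Nat.Tactic.RingSolver as ℕ-Solver
  open import Data.Integer using (+_; _-_; _*_; -_)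
  open import Data.Integer.Tactic.RingSolver using (solve-∀)
  open import Data.Fin using (Fin; toℕ)
  open import Data.Fin.Patterns using (0F; 1F; 2F; 3F)
  open import Data.Fin.Subset using (Subset; ⊥; ∣_∣; inside; outside)
  open import Data.Vec using (Vec; []; _∷_; lookup; zipWith; replicate; map)
  open import Data.Vec.Properties using (zipWith-assoc; zipWith-comm; zipWith-identityʳ; zipWith-identityˡ; lookup-zipWith)
  open import Data.Product using (_×_; _,_; proj₁; proj₂)
  open import Relation.Nullary.Decidable using (_×-dec_)
  open import Relation.Binary.PropositionalEquality using (refl; sym; trans; cong; cong₂; module ≡-Reasoning)
  open import Data.Fin.Subset.Properties using (∣p∣≤n)
  open import Defs using (ZpCube; Seq; allSubsets; sumSel; zeroSum?; count)
  open Sums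
  open Subsets using (sign; coSign; coSign≡; sign-2*; sum-size-zero)
  open DivisibilityIndicator isPrime using (indicator≡1-power)
  open Weights u isPrime public

  V : Set
  V = Vec ℕ 4

  _⊕_ : V → V → V
  _⊕_ = zipWith ℕ._+_

  origin : V
  origin = replicate 4 0

  open FiniteDifferences _⊕_ origin (zipWith-assoc +-assoc) (zipWith-comm +-comm) (zipWith-identityʳ +-identityʳ)
                         (+ p) public

  -- The indicator of p ∣ v_i, as a function of v; it has degree < p by Fermat.
  Φ : Fin 4 → Fn
  Φ i v = φ (lookup v i)

  degreeBelow-Φ : ∀ i → DegreeBelow p (Φ i)
  degreeBelow-Φ i = degreeBelow-mod (λ v → indicator≡1-power (lookup v i))
    (degreeBelow-⊖ (degreeBelow-mono (s≤s z≤n) (degreeBelow-const (+ 1)))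
                   (degreeBelow-power (λ v → lookup v i) (lookup-zipWith ℕ._+_ i) m))

  e₄ : V
  e₄ = 0 ∷ 0 ∷ 0 ∷ 1 ∷ []

  zeroSumPart : Fn
  zeroSumPart = Φ 0F ⊠ (Φ 1F ⊠ Φ 2F)

  f : Fn
  f = zeroSumPart ⊠ Δ e₄ (Φ 3F)

  -- deg f ≤ 3 (p - 1) + (p - 2) < 4 p - 4 = n.
  degreeBelow-f : DegreeBelow n f
  degreeBelow-f = degreeBelow-mono (≤-reflexive (degree-count u))
    (degreeBelow-⊠ (m ℕ.+ (m ℕ.+ m)) (suc (suc u))
      (degreeBelow-⊠ m (m ℕ.+ m) (degreeBelow-Φ _) (degreeBelow-⊠ m m (degreeBelow-Φ _) (degreeBelow-Φ _)))
      (degreeBelow-Δ e₄ (degreeBelow-Φ _)))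
    where
    degree-count : ∀ u → suc ((3 ℕ.+ u) ℕ.+ ((3 ℕ.+ u) ℕ.+ (3 ℕ.+ u)) ℕ.+ (2 ℕ.+ u)) ≡
                         u ℕ.+ 3 ℕ.* (4 ℕ.+ u)
    degree-count = ℕ-Solver.solve-∀

  -- A term of J becomes the direction (x₁, x₂, x₃, 1); the last coordinate counts terms.
  lift : ZpCube p → V
  lift (a , b , c) = toℕ a ∷ toℕ b ∷ toℕ c ∷ 1 ∷ []

  steps : ∀ {k} → Seq p k → Vec V k
  steps = map lift

  withSize : ℕ × ℕ × ℕ → ℕ → V
  withSize (a , b , c) k = a ∷ b ∷ c ∷ k ∷ []

  selectedSum-steps : ∀ {k} (J : Seq p k) S → selectedSum (steps J) S ≡ withSize (sumSel J S) ∣ S ∣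
  selectedSum-steps [] [] = refl
  selectedSum-steps (x ∷ J) (outside ∷ S) = selectedSum-steps J S
  selectedSum-steps (x ∷ J) (inside ∷ S) = cong (lift x ⊕_) (selectedSum-steps J S)

  zeroSum-indicator : ∀ {k} (J : Seq p k) S → 𝟙 (zeroSum? J S) ≡ zeroSumPart (selectedSum (steps J) S)
  zeroSum-indicator J S rewrite selectedSum-steps J S =
    trans (𝟙-× (a % p ≟ 0) _) (cong (𝟙 (a % p ≟ 0) *_) (𝟙-× (b % p ≟ 0) (c % p ≟ 0)))
    where
    a = proj₁ (sumSel J S)
    b = proj₁ (proj₂ (sumSel J S))
    c = proj₂ (proj₂ (sumSel J S))

  empty-zeroSum : ∀ {k} (J : Seq p k) → 𝟙 (zeroSum? J ⊥) ≡ + 1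
  empty-zeroSum J = trans (zeroSum-indicator J ⊥) (cong zeroSumPart (selectedSum-⊥ (steps J)))

  sign-n : sign n ≡ + 1
  sign-n = trans (cong sign (n-even u)) (sign-2* (6 ℕ.+ 2 ℕ.* u))
    where
    n-even : ∀ u → u ℕ.+ 3 ℕ.* (4 ℕ.+ u) ≡ 2 ℕ.* (6 ℕ.+ 2 ℕ.* u)
    n-even = ℕ-Solver.solve-∀

  contribution : (J : Seq p n) (S : Subset n) →
                 coSign S * f (selectedSum (steps J) S) ≡ - (θ ∣ S ∣ * 𝟙 (zeroSum? J S))
  contribution J S = begin
    coSign S * f v
      ≡⟨ cong₂ _*_ (trans (coSign≡ S) (cong (_* sign k) sign-n))
                   (cong₂ _*_ (sym (zeroSum-indicator J S)) (cong₂ _-_ (cong φ size-after-e₄) (cong φ size))) ⟩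
    + 1 * sign k * (Z * (φ (suc k) - φ k))
      ≡⟨ regroup (sign k) Z (φ (suc k) - φ k) ⟩
    sign k * (φ (suc k) - φ k) * Z
      ≡⟨ cong (_* Z) (weight-as-difference k (∣p∣≤n S)) ⟩
    - θ k * Z
      ≡⟨ pull-neg (θ k) Z ⟩
    - (θ k * Z) ∎
    where
    open ≡-Reasoning
    v = selectedSum (steps J) S
    k = ∣ S ∣
    Z = 𝟙 (zeroSum? J S)
    size : lookup v 3F ≡ k
    size = cong (λ w → lookup w 3F) (selectedSum-steps J S)
    size-after-e₄ : lookup (v ⊕ e₄) 3F ≡ suc k
    size-after-e₄ = trans (lookup-zipWith ℕ._+_ _ v e₄) (trans (cong (ℕ._+ 1) size) (+-comm k 1))
    regroup : ∀ s z d → + 1 * s * (z * d) ≡ s * d * z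
    regroup = solve-∀
    pull-neg : ∀ t z → - t * z ≡ - (t * z)
    pull-neg = solve-∀

  count-as-sum : ∀ j (J : Seq p n) → + count j J ≡ ∑[ S ∈ allSubsets n ] (𝟙 (∣ S ∣ ≟ j) * 𝟙 (zeroSum? J S))
  count-as-sum j J = trans (length-filter (λ S → (∣ S ∣ ≟ j) ×-dec zeroSum? J S) (allSubsets n))
                           (sum-cong (allSubsets n) (λ S → 𝟙-× (∣ S ∣ ≟ j) (zeroSum? J S)))

  difference-along-J : (J : Seq p n) → Δ⋆ (steps J) f origin ≡ - Λ (+ 1) (λ j → + count j J)
  difference-along-J J = begin
    Δ⋆ (steps J) f origin
      ≡⟨ Δ⋆-expansion (steps J) f origin ⟩
    ∑[ S ∈ A ] (coSign S * f (origin ⊕ selectedSum (steps J) S))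
      ≡⟨ sum-cong A (λ S → trans (cong (λ v → coSign S * f v) (origin-⊕ (selectedSum (steps J) S)))
                                  (contribution J S)) ⟩
    ∑[ S ∈ A ] (- (θ ∣ S ∣ * Z S))
      ≡⟨ sum-neg A (λ S → θ ∣ S ∣ * Z S) ⟩
    - ∑[ S ∈ A ] (θ ∣ S ∣ * Z S)
      ≡⟨ cong -_ (sum-cong A (λ S → Λ-scaleʳ (Z S) (𝟙 (∣ S ∣ ≟ 0)) (λ j → 𝟙 (∣ S ∣ ≟ j)))) ⟩
    - ∑[ S ∈ A ] (Λ (𝟙 (∣ S ∣ ≟ 0) * Z S) (λ j → 𝟙 (∣ S ∣ ≟ j) * Z S))
      ≡⟨ cong -_ (sum-Λ A (λ S → 𝟙 (∣ S ∣ ≟ 0) * Z S) (λ S j → 𝟙 (∣ S ∣ ≟ j) * Z S)) ⟩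
    - Λ (∑[ S ∈ A ] (𝟙 (∣ S ∣ ≟ 0) * Z S)) (λ j → ∑[ S ∈ A ] (𝟙 (∣ S ∣ ≟ j) * Z S))
      ≡⟨ cong -_ (Λ-cong (trans (sum-size-zero n Z) (empty-zeroSum J)) (λ j → sym (count-as-sum j J))) ⟩
    - Λ (+ 1) (λ j → + count j J) ∎
    where
    open ≡-Reasoning
    A = allSubsets n
    Z : Subset n → ℤ
    Z S = 𝟙 (zeroSum? J S)
    origin-⊕ : ∀ v → origin ⊕ v ≡ v
    origin-⊕ = zipWith-identityˡ +-identityˡ

open import Defs
open import Data.Nat using (ℕ; suc; _<_; _∸_; _*_; NonZero; s≤s; z≤n)
open import Data.Nat.Properties using (≤-refl)
open import Data.Nat.Primality using (Prime)
open import Data.Integer using (ℤ; +_; _+_; _-_; -_)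
open import Data.Integer.Properties using (neg-involutive)
open import Data.Integer.Divisibility using (_∣_)
open import Data.Integer.Divisibility.Signed using (∣⇒∣ᵤ; ∣m⇒∣-m) renaming (_∣_ to _∣ˢ_)
open import Relation.Binary.PropositionalEquality using (subst)

proposition5p1 : (p : ℕ) → .{{_ : NonZero p}} → Prime p → 3 < p → (J : Seq p (4 * p ∸ 4)) →
    (+ p) ∣ (+ 1 - + count (p ∸ 1) J - + count p J + + count (2 * p ∸ 1) J + + count (2 * p) J
    - + count (3 * p ∸ 1) J - + count (3 * p) J)
proposition5p1 _ isPrime (s≤s (s≤s (s≤s (s≤s (z≤n {u}))))) J =
  ∣⇒∣ᵤ (subst (+ p ∣ˢ_) (neg-involutive _) (∣m⇒∣-m p∣-count))
  where
  open ZeroSumCounting u isPrime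
  -- deg f < n = |J|, so the n-fold difference of f along the terms of J vanishes mod p;
  p∣difference : + p ∣ˢ Δ⋆ (steps J) f origin
  p∣difference = degreeBelow-f (steps J) ≤-refl origin
  -- by inclusion–exclusion it is minus the alternating count of the theorem.
  p∣-count : + p ∣ˢ - Λ (+ 1) (λ j → + count j J)
  p∣-count = subst (+ p ∣ˢ_) (difference-along-J J) p∣difference
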